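{- Let $G$ be a graph, $k\geq 1$ an integer, and $d:=\Delta(G^{\lfloor k/2\rfloor})$. Then $G^k$ is a $\lfloor k/2\rfloor$-shallow minor of $G\circ\overline{K_{d+1}}$.
   Context: All graphs are finite and simple. For $j\geq 0$, the $j$-th power $G^j$ has vertex set $V(G)$ with distinct $u,v$ adjacent iff $\mathrm{dist}_G(u,v)\leq j$ (so $G^0$ is edgeless); $\Delta$ denotes maximum degree. $\overline{K_{d+1}}$ is the edgeless graph on $d+1$ vertices; the lexicographic product $A\circ B$ has vertex set $V(A)\times V(B)$, with $(a,v)(b,u)$ an edge iff $ab\in E(A)$, or $a=b$ and $uv\in E(B)$. $H$ is an $r$-shallow minor of $X$ if there is a map $\mu$ assigning to each $v\in V(H)$ a connected subgraph $\mu(v)$ of $X$ of radius at most $r$, pairwise vertex-disjoint, such that for every edge $vw\in E(H)$ some edge of $X$ joins $\mu(v)$ and $\mu(w)$. -}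

module Defs where

open import Data.Nat using (ℕ; zero; suc; _⊔_; _+_)
open import Data.Fin using (Fin; _≟_)
open import Data.Bool using (Bool; true; false; _∧_; _∨_; not; if_then_else_)
open import Data.List using (List; allFin; map; foldr)
open import Data.Bool.ListAction using (any)
open import Data.Nat.ListAction using (sum)
open import Data.Product using (Σ; _×_; _,_)
open import Data.Sum using (_⊎_)
open import Relation.Binary.PropositionalEquality using (_≡_)
open import Relation.Nullary.Decidable using (⌊_⌋)

record Graph (n : ℕ) : Set where
  field
    adj : Fin n → Fin n → Bool
open Graph public

record IsSimple {n : ℕ} (G : Graph n) : Set where
  field
    adj-sym     : ∀ u v → adj G u v ≡ adj G v u
    adj-irrefl  : ∀ v → adj G v v ≡ false

within : ∀ {n} → Graph n → ℕ → Fin n → Fin n → Bool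
within G zero    u v = ⌊ u ≟ v ⌋
within G (suc j) u v = ⌊ u ≟ v ⌋ ∨ any (λ w → adj G u w ∧ within G j w v) (allFin _)

power : ∀ {n} → Graph n → ℕ → Graph n
adj (power G j) u v = not ⌊ u ≟ v ⌋ ∧ within G j u v

degree : ∀ {n} → Graph n → Fin n → ℕ
degree {n} G v = sum (map (λ u → if adj G v u then 1 else 0) (allFin n))

maxDegree : ∀ {n} → Graph n → ℕ
maxDegree {n} G = foldr _⊔_ 0 (map (degree G) (allFin n))

edgeless : (m : ℕ) → Graph m
adj (edgeless m) u v = false

LexAdj : ∀ {n m} → Graph n → Graph m → Fin n × Fin m → Fin n × Fin m → Set
LexAdj A B (a , v) (b , u) = (adj A a b ≡ true) ⊎ ((a ≡ b) × (adj B v u ≡ true))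

-- WalkIn Adj P ℓ x y : a walk of length at most ℓ from x to y in the graph with
-- adjacency relation Adj, all of whose vertices satisfy P (i.e. a walk in the
-- subgraph induced by P).
data WalkIn {W : Set} (Adj : W → W → Set) (P : W → Set) : ℕ → W → W → Set where
  nil  : ∀ {ℓ x} → P x → WalkIn Adj P ℓ x x
  cons : ∀ {ℓ x y z} → P x → Adj x y → WalkIn Adj P ℓ y z → WalkIn Adj P (suc ℓ) x z

-- H is an r-shallow minor of the graph X = (W, Adj):
-- branch sets μ v ⊆ W, each nonempty, connected of radius ≤ r (some centre reaches every
-- vertex of μ v by a walk of length ≤ r inside μ v), pairwise disjoint, and every edge of H
-- is realised by an edge of X between the corresponding branch sets.
record ShallowMinor {m : ℕ} (r : ℕ) (H : Graph m) {W : Set} (Adj : W → W → Set) : Set₁ where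
  field
    μ        : Fin m → W → Set
    centre   : Fin m → W
    centre∈  : ∀ v → μ v (centre v)
    radius   : ∀ v x → μ v x → WalkIn Adj (μ v) r (centre v) x
    disjoint : ∀ v w x → μ v x → μ w x → v ≡ w
    edges    : ∀ v w → adj H v w ≡ true →
               Σ W (λ x → Σ W (λ y → μ v x × μ w y × Adj x y))

{-# OPTIONS --safe #-}
module Submission where

-- Put h = ⌊k/2⌋ and D = Δ(G^h) + 1. The h-ball around any vertex u has at most
-- 1 + deg_{G^h}(u) ≤ D vertices, so u can label the members of its ball injectively
-- by colours in Fin D (its rank among them). The branch set of v is
-- { (u , label_u(v)) : dist(u,v) ≤ h }. Injectivity of the labels makes branch sets
-- disjoint; a walk of length ≤ h from v to u stays inside the branch set of v, since
-- every vertex on it is within distance h of v; and a walk of length ≤ k ≤ 2h+1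
-- between distinct v, w has an edge ab with a within h of v and b within h of w.

open import Defs
open import Data.Nat using (ℕ; zero; suc; _≥_; ⌊_/2⌋; ⌈_/2⌉; _+_; _≤_; _<_; _⊔_; z≤n; s≤s)
open import Data.Nat.Properties
  using (≤-refl; ≤-trans; n≤1+n; m≤n+m; m≤m⊔n; m≤n⇒m≤o⊔n; +-suc; +-mono-≤; +-monoʳ-≤;
         +-monoʳ-<; +-cancelˡ-≡; ⌊n/2⌋-mono; ⌊n/2⌋+⌈n/2⌉≡n; module ≤-Reasoning)
open import Data.Fin using (Fin; zero; suc; toℕ; fromℕ<; _≟_)
open import Data.Fin.Properties using (toℕ-fromℕ<; toℕ-injective; suc-injective)
open import Data.Bool using (Bool; true; false; _∧_; _∨_; if_then_else_)
open import Data.Bool.Properties using (∨-zeroʳ; T-≡)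
open import Data.Bool.ListAction using (any)
open import Data.Nat.ListAction using (sum)
open import Data.List using (tabulate; foldr; allFin)
open import Data.List.Properties using (map-tabulate)
open import Data.List.Relation.Unary.Any using (here; there; satisfied)
open import Data.List.Relation.Unary.Any.Properties using (any⁺; any⁻)
open import Data.List.Membership.Propositional using (_∈_; lose)
open import Data.List.Membership.Propositional.Properties using (∈-allFin; ∈-map⁺)
open import Data.Product using (Σ; ∃; ∃₂; _×_; _,_; proj₁; map₂)
open import Data.Sum using (_⊎_; inj₁; inj₂; [_,_]′; map₁)
open import Data.Empty using (⊥-elim)
open import Function using (_∘_; id)
open import Function.Bundles using (module Equivalence)
open import Relation.Nullary using (yes; no)
open import Relation.Nullary.Decidable using (⌊_⌋; isYes≗does; dec-true)
open import Relation.Binary.PropositionalEquality using (_≡_; _≢_; refl; sym; trans; cong)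

open Equivalence using (to; from)

indicator : Bool → ℕ
indicator b = if b then 1 else 0

count : ∀ {n} → (Fin n → Bool) → ℕ
count f = sum (tabulate (indicator ∘ f))

rank : ∀ {n} → (Fin n → Bool) → Fin n → ℕ
rank f zero    = 0
rank f (suc i) = indicator (f zero) + rank (f ∘ suc) i

indicator≤1 : ∀ b → indicator b ≤ 1
indicator≤1 false = z≤n
indicator≤1 true  = ≤-refl

indicator-mono : ∀ {a b} → (a ≡ true → b ≡ true) → indicator a ≤ indicator b
indicator-mono {false} _   = z≤n
indicator-mono {true}  a⇒b rewrite a⇒b refl = ≤-refl

count-mono : ∀ {n} {f g : Fin n → Bool} → (∀ v → f v ≡ true → g v ≡ true) → count f ≤ count g
count-mono {zero}  f⊆g = z≤n
count-mono {suc n} f⊆g = +-mono-≤ (indicator-mono (f⊆g zero)) (count-mono (f⊆g ∘ suc))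

count-⊆-insert : ∀ {n} {f g : Fin n → Bool} (u : Fin n) →
                 (∀ v → f v ≡ true → v ≡ u ⊎ g v ≡ true) → count f ≤ suc (count g)
count-⊆-insert {f = f} {g} zero f⊆g∪u = +-mono-≤ (indicator≤1 (f zero)) (begin
  count (f ∘ suc) ≤⟨ count-mono (λ v fv → [ (λ ()) , id ]′ (f⊆g∪u (suc v) fv)) ⟩
  count (g ∘ suc) ≤⟨ m≤n+m _ (indicator (g zero)) ⟩
  count g         ∎)
  where open ≤-Reasoning
count-⊆-insert {f = f} {g} (suc u) f⊆g∪u = begin
  count f                                    ≤⟨ +-mono-≤ (indicator-mono f₀⇒g₀) (count-⊆-insert u f⊆g∪u′) ⟩
  indicator (g zero) + suc (count (g ∘ suc)) ≡⟨ +-suc _ _ ⟩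
  suc (count g)                              ∎
  where
  open ≤-Reasoning
  f₀⇒g₀ : f zero ≡ true → g zero ≡ true
  f₀⇒g₀ f₀ = [ (λ ()) , id ]′ (f⊆g∪u zero f₀)
  f⊆g∪u′ : ∀ v → f (suc v) ≡ true → v ≡ u ⊎ g (suc v) ≡ true
  f⊆g∪u′ v fv = map₁ suc-injective (f⊆g∪u (suc v) fv)

rank<count : ∀ {n} (f : Fin n → Bool) {i} → f i ≡ true → rank f i < count f
rank<count f {zero}  fi rewrite fi = s≤s z≤n
rank<count f {suc i} fi = +-monoʳ-< (indicator (f zero)) (rank<count (f ∘ suc) fi)

rank-injective : ∀ {n} (f : Fin n → Bool) {i j} → f i ≡ true → f j ≡ true →
                 rank f i ≡ rank f j → i ≡ j
rank-injective f {zero}  {zero}  _  _  _ = refl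
rank-injective f {zero}  {suc j} fi _  eq rewrite fi with () ← eq
rank-injective f {suc i} {zero}  _  fj eq rewrite fj with () ← eq
rank-injective f {suc i} {suc j} fi fj eq =
  cong suc (rank-injective (f ∘ suc) fi fj (+-cancelˡ-≡ (indicator (f zero)) _ _ eq))

∈⇒≤foldr-⊔ : ∀ {x xs} → x ∈ xs → x ≤ foldr _⊔_ 0 xs
∈⇒≤foldr-⊔ (here refl)  = m≤m⊔n _ _
∈⇒≤foldr-⊔ (there x∈xs) = m≤n⇒m≤o⊔n _ (∈⇒≤foldr-⊔ x∈xs)

any-true⁺ : ∀ {A : Set} (p : A → Bool) {x xs} → x ∈ xs → p x ≡ true → any p xs ≡ true
any-true⁺ p x∈xs px = to T-≡ (any⁺ p (lose x∈xs (from T-≡ px)))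

any-true⁻ : ∀ {A : Set} (p : A → Bool) xs → any p xs ≡ true → ∃ λ x → p x ≡ true
any-true⁻ p xs any≡true = map₂ (to T-≡) (satisfied (any⁻ p xs (from T-≡ any≡true)))

⌊≟⌋-refl : ∀ {n} (u : Fin n) → ⌊ u ≟ u ⌋ ≡ true
⌊≟⌋-refl u = trans (isYes≗does (u ≟ u)) (dec-true (u ≟ u) refl)

module _ {n} (G : Graph n) where

  degree≡count : ∀ u → degree G u ≡ count (adj G u)
  degree≡count u = cong sum (map-tabulate id (indicator ∘ adj G u))

  degree≤maxDegree : ∀ u → degree G u ≤ maxDegree G
  degree≤maxDegree u = ∈⇒≤foldr-⊔ (∈-map⁺ (degree G) (∈-allFin u))

  -- The index is only an upper bound on the length: [] inhabits Walk ℓ u u for every ℓ.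
  data Walk : ℕ → Fin n → Fin n → Set where
    []  : ∀ {ℓ u} → Walk ℓ u u
    _∷_ : ∀ {ℓ u w v} → adj G u w ≡ true → Walk ℓ w v → Walk (suc ℓ) u v

  Walk-weaken : ∀ {ℓ ℓ′ u v} → Walk ℓ u v → ℓ ≤ ℓ′ → Walk ℓ′ u v
  Walk-weaken []       _          = []
  Walk-weaken (e ∷ p) (s≤s ℓ≤ℓ′) = e ∷ Walk-weaken p ℓ≤ℓ′

  _∷ʳ_ : ∀ {ℓ u v w} → Walk ℓ u v → adj G v w ≡ true → Walk (suc ℓ) u w
  []      ∷ʳ f = f ∷ []
  (e ∷ p) ∷ʳ f = e ∷ (p ∷ʳ f)

  Walk-reverse : (∀ u v → adj G u v ≡ adj G v u) → ∀ {ℓ u v} → Walk ℓ u v → Walk ℓ v u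
  Walk-reverse adj-sym []                     = []
  Walk-reverse adj-sym (_∷_ {u = u} {w} e p) = Walk-reverse adj-sym p ∷ʳ trans (adj-sym w u) e

  Walk⇒within : ∀ {ℓ u v} → Walk ℓ u v → within G ℓ u v ≡ true
  Walk⇒within {zero}  {u} [] = ⌊≟⌋-refl u
  Walk⇒within {suc ℓ} {u} [] =
    cong (_∨ any (λ w → adj G u w ∧ within G ℓ w u) (allFin n)) (⌊≟⌋-refl u)
  Walk⇒within {suc ℓ} {u} {v} (_∷_ {w = w} e p) =
    trans (cong (⌊ u ≟ v ⌋ ∨_) (any-true⁺ _ (∈-allFin w) e∧p)) (∨-zeroʳ _)
    where
    e∧p : adj G u w ∧ within G ℓ w v ≡ true
    e∧p = trans (cong (_∧ within G ℓ w v) e) (Walk⇒within p)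

  within⇒Walk : ∀ ℓ u v → within G ℓ u v ≡ true → Walk ℓ u v
  within⇒Walk zero u v uv with u ≟ v
  ... | yes refl = []
  within⇒Walk (suc ℓ) u v uv with u ≟ v
  ... | yes refl = []
  ... | no _
    with w , e∧p ← any-true⁻ (λ w → adj G u w ∧ within G ℓ w v) (allFin n) uv
    with adj G u w in e
  ... | true = e ∷ within⇒Walk ℓ w v e∧p

  Walk-split : ∀ p {q v w} → Walk (p + suc q) v w → v ≢ w →
               ∃₂ λ a b → Walk p v a × adj G a b ≡ true × Walk q b w
  Walk-split zero    []                     v≢w = ⊥-elim (v≢w refl)
  Walk-split zero    (_∷_ {w = b} e rest)   _   = _ , b , [] , e , rest
  Walk-split (suc p) []                     v≢w = ⊥-elim (v≢w refl)
  Walk-split (suc p) {w = w} (_∷_ {w = b} e rest) v≢w with b ≟ w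
  ... | yes refl = _ , b , [] , e , []
  ... | no b≢w with a , b′ , va , ab′ , b′w ← Walk-split p rest b≢w
    = a , b′ , e ∷ va , ab′ , b′w

WalkIn-snoc : ∀ {W : Set} {Adj : W → W → Set} {P : W → Set} {ℓ x y z} →
              WalkIn Adj P ℓ x y → Adj y z → P z → WalkIn Adj P (suc ℓ) x z
WalkIn-snoc (nil py)          yz pz = cons py yz (nil pz)
WalkIn-snoc (cons px xy rest) yz pz = cons px xy (WalkIn-snoc rest yz pz)

n≤⌊n/2⌋+[1+⌊n/2⌋] : ∀ n → n ≤ ⌊ n /2⌋ + suc ⌊ n /2⌋
n≤⌊n/2⌋+[1+⌊n/2⌋] n = begin
  n                        ≡⟨ sym (⌊n/2⌋+⌈n/2⌉≡n n) ⟩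
  ⌊ n /2⌋ + ⌈ n /2⌉        ≤⟨ +-monoʳ-≤ ⌊ n /2⌋ (⌊n/2⌋-mono (n≤1+n (suc n))) ⟩
  ⌊ n /2⌋ + suc ⌊ n /2⌋    ∎
  where open ≤-Reasoning

module BranchSets {n} (G : Graph n) (G-simple : IsSimple G) (h : ℕ) where
  open IsSimple G-simple

  D : ℕ
  D = suc (maxDegree (power G h))

  Vertex : Set
  Vertex = Fin n × Fin D

  Adj : Vertex → Vertex → Set
  Adj = LexAdj G (edgeless D)

  ball : Fin n → Fin n → Bool
  ball u = within G h u

  rank<D : ∀ u {v} → ball u v ≡ true → rank (ball u) v < D
  rank<D u {v} uv = begin-strict
    rank (ball u) v                 <⟨ rank<count (ball u) uv ⟩
    count (ball u)                  ≤⟨ count-⊆-insert u ball⊆nbhd∪u ⟩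
    suc (count (adj (power G h) u)) ≡⟨ cong suc (sym (degree≡count (power G h) u)) ⟩
    suc (degree (power G h) u)      ≤⟨ s≤s (degree≤maxDegree (power G h) u) ⟩
    D                               ∎
    where
    open ≤-Reasoning
    ball⊆nbhd∪u : ∀ w → ball u w ≡ true → w ≡ u ⊎ adj (power G h) u w ≡ true
    ball⊆nbhd∪u w uw with u ≟ w
    ... | yes refl = inj₁ refl
    ... | no _     = inj₂ uw

  label : ∀ u {v} → ball u v ≡ true → Fin D
  label u uv = fromℕ< (rank<D u uv)

  μ : Fin n → Vertex → Set
  μ v (u , i) = ball u v ≡ true × toℕ i ≡ rank (ball u) v

  label∈μ : ∀ u {v} (uv : ball u v ≡ true) → μ v (u , label u uv)
  label∈μ u uv = uv , toℕ-fromℕ< (rank<D u uv)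

  μ-label-unique : ∀ {v u i j} → μ v (u , i) → μ v (u , j) → i ≡ j
  μ-label-unique (_ , i≡rank) (_ , j≡rank) = toℕ-injective (trans i≡rank (sym j≡rank))

  μ-disjoint : ∀ v w x → μ v x → μ w x → v ≡ w
  μ-disjoint v w (u , i) (uv , i≡rv) (uw , i≡rw) =
    rank-injective (ball u) uv uw (trans (sym i≡rv) i≡rw)

  ball-centre : ∀ v → ball v v ≡ true
  ball-centre v = Walk⇒within G {h} []

  centre : Fin n → Vertex
  centre v = v , label v (ball-centre v)

  walk-from-centre : ∀ {ℓ u v i} → Walk G ℓ u v → ℓ ≤ h → μ v (u , i) →
                     WalkIn Adj (μ v) ℓ (centre v) (u , i)
  walk-from-centre {v = v} [] _ v∈μ
    rewrite μ-label-unique (label∈μ v (ball-centre v)) v∈μ = nil v∈μ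
  walk-from-centre {u = u} {v} (_∷_ {ℓ′} {w = w} uw wv) ℓ≤h u∈μ =
    WalkIn-snoc (walk-from-centre wv ℓ′≤h (label∈μ w w∈ball))
                (inj₁ (trans (adj-sym w u) uw)) u∈μ
    where
    ℓ′≤h : ℓ′ ≤ h
    ℓ′≤h = ≤-trans (n≤1+n _) ℓ≤h
    w∈ball : ball w v ≡ true
    w∈ball = Walk⇒within G (Walk-weaken G wv ℓ′≤h)

  radius : ∀ v x → μ v x → WalkIn Adj (μ v) h (centre v) x
  radius v (u , i) u∈μ = walk-from-centre (within⇒Walk G h u v (proj₁ u∈μ)) ≤-refl u∈μ

  edges : ∀ {k} → k ≤ h + suc h → ∀ v w → adj (power G k) v w ≡ true →
          Σ Vertex λ x → Σ Vertex λ y → μ v x × μ w y × Adj x y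
  edges {k} k≤2h+1 v w vw with v ≟ w
  ... | no v≢w
    with a , b , va , ab , bw ← Walk-split G h (Walk-weaken G (within⇒Walk G k v w vw) k≤2h+1) v≢w
    = (a , label a av) , (b , label b bw′) , label∈μ a av , label∈μ b bw′ , inj₁ ab
    where
    av : ball a v ≡ true
    av = Walk⇒within G (Walk-reverse G adj-sym va)
    bw′ : ball b w ≡ true
    bw′ = Walk⇒within G bw

lemma26 : ∀ {n} (G : Graph n) → IsSimple G → (k : ℕ) → k ≥ 1 →
            ShallowMinor ⌊ k /2⌋ (power G k)
              (LexAdj G (edgeless (suc (maxDegree (power G ⌊ k /2⌋)))))
lemma26 G G-simple k _ = record
  { μ        = μ
  ; centre   = centre
  ; centre∈  = λ v → label∈μ v (ball-centre v)
  ; radius   = radius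
  ; disjoint = μ-disjoint
  ; edges    = edges (n≤⌊n/2⌋+[1+⌊n/2⌋] k)
  }
  where open BranchSets G G-simple ⌊ k /2⌋
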